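{- If $A$ is an introenumerable set whose complement is c.e., then $A$ is introreducible.
   Context: An enumeration operator $\Theta$ is a c.e. set of pairs $\langle u,n\rangle$, with $\Theta(X)=\{n:\exists u\,(D_u\subseteq X\wedge\langle u,n\rangle\in\Theta)\}$; $A\le_e X$ if $A=\Theta(X)$ for some enumeration operator. An infinite set $A$ is introenumerable if $A\le_e C$ for every infinite $C\subseteq A$, and introreducible if $A\le_T C$ for every infinite $C\subseteq A$. -}

module Defs where

open import Data.Nat using (ℕ; zero; suc; _+_; _*_; _≤_; _<_)
open import Data.Nat.DivMod using (_/_; _%_)
open import Data.Bool using (Bool; true; false; if_then_else_)
open import Data.Fin using (Fin)
open import Data.Vec using (Vec; []; _∷_; lookup)
open import Data.Product using (Σ; ∃; _×_; _,_)
open import Relation.Binary.PropositionalEquality using (_≡_)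
open import Function.Bundles using (_⇔_)

SetN : Set
SetN = ℕ → Bool

-- Oracle μ-recursive functions (the model of relative computability)

data Code : ℕ → Set where
  zer  : ∀ {n} → Code n
  succ : Code 1
  proj : ∀ {n} → Fin n → Code n
  orc  : Code 1
  comp : ∀ {m n} → Code m → Vec (Code n) m → Code n
  prec : ∀ {n} → Code n → Code (suc (suc n)) → Code (suc n)
  mu   : ∀ {n} → Code (suc n) → Code n

χ : Bool → ℕ
χ b = if b then 1 else 0

mutual
  data Eval (X : SetN) : ∀ {n} → Code n → Vec ℕ n → ℕ → Set where
    ev-zer  : ∀ {n} {xs : Vec ℕ n} → Eval X zer xs 0
    ev-succ : ∀ {x} → Eval X succ (x ∷ []) (suc x)
    ev-proj : ∀ {n} (i : Fin n) {xs : Vec ℕ n} → Eval X (proj i) xs (lookup xs i)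
    ev-orc  : ∀ {x} → Eval X orc (x ∷ []) (χ (X x))
    ev-comp : ∀ {m n} {f : Code m} {gs : Vec (Code n) m} {xs : Vec ℕ n}
                {ys : Vec ℕ m} {r : ℕ} →
              EvalVec X gs xs ys → Eval X f ys r → Eval X (comp f gs) xs r
    ev-prec0 : ∀ {n} {f : Code n} {g : Code (suc (suc n))} {xs : Vec ℕ n} {r : ℕ} →
               Eval X f xs r → Eval X (prec f g) (0 ∷ xs) r
    ev-precS : ∀ {n} {f : Code n} {g : Code (suc (suc n))} {xs : Vec ℕ n}
                 {k r s : ℕ} →
               Eval X (prec f g) (k ∷ xs) r → Eval X g (k ∷ r ∷ xs) s →
               Eval X (prec f g) (suc k ∷ xs) s
    ev-mu   : ∀ {n} {f : Code (suc n)} {xs : Vec ℕ n} {x : ℕ} →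
              Eval X f (x ∷ xs) 0 →
              (∀ y → y < x → Σ ℕ λ k → Eval X f (y ∷ xs) (suc k)) →
              Eval X (mu f) xs x

  data EvalVec (X : SetN) {n : ℕ} : ∀ {m} → Vec (Code n) m → Vec ℕ n → Vec ℕ m → Set where
    []  : ∀ {xs} → EvalVec X [] xs []
    _∷_ : ∀ {m} {g : Code n} {gs : Vec (Code n) m} {xs : Vec ℕ n} {y : ℕ} {ys : Vec ℕ m} →
          Eval X g xs y → EvalVec X gs xs ys → EvalVec X (g ∷ gs) xs (y ∷ ys)

-- The empty oracle (used for unrelativised computability).
∅ : SetN
∅ _ = false

CE : SetN → Set
CE W = Σ (Code 1) λ c → ∀ n → (W n ≡ true) ⇔ (∃ λ r → Eval ∅ c (n ∷ []) r)

∁ : SetN → SetN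
∁ A n = if A n then false else true

tri : ℕ → ℕ
tri zero    = 0
tri (suc k) = suc k + tri k

⟨_,_⟩ : ℕ → ℕ → ℕ
⟨ u , n ⟩ = tri (u + n) + n

bit : ℕ → ℕ → ℕ
bit u zero    = u % 2
bit u (suc i) = bit (u / 2) i

-- i ∈ D_u  (D_u is the finite set with canonical index u)
_∈D_ : ℕ → ℕ → Set
i ∈D u = bit u i ≡ 1

_⊆_ : SetN → SetN → Set
A ⊆ B = ∀ n → A n ≡ true → B n ≡ true

-- A ≤_e X : A = Θ(X) for some enumeration operator (c.e. set of pairs) Θ
_≤e_ : SetN → SetN → Set
A ≤e X = Σ SetN λ Θ → CE Θ ×
           (∀ n → (A n ≡ true) ⇔
                  (∃ λ u → (∀ i → i ∈D u → X i ≡ true) × Θ ⟨ u , n ⟩ ≡ true))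

_≤T_ : SetN → SetN → Set
A ≤T X = Σ (Code 1) λ c → ∀ n → Eval X c (n ∷ []) (χ (A n))

Infinite : SetN → Set
Infinite A = ∀ m → ∃ λ n → m ≤ n × A n ≡ true

Introenumerable : SetN → Set
Introenumerable A = Infinite A × (∀ C → Infinite C → C ⊆ A → A ≤e C)

Introreducible : SetN → Set
Introreducible A = Infinite A × (∀ C → Infinite C → C ⊆ A → A ≤T C)

{-# OPTIONS --safe #-}

-- For an infinite C ⊆ A, A ≤e C makes A c.e. relative to C: n ∈ A iff ⟨u, n⟩ ∈ Θ for some
-- finite D_u ⊆ C, and both facts are confirmed at a finite stage of a C-computable enumeration,
-- because D_u ⊆ {0, …, u − 1}.  The complement of A is c.e. outright.  So A and its complement
-- are both c.e. in C, and C decides n ∈ A by searching for the first stage at which n has been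
-- enumerated into one of them.  Stages are made computable by a step-bounded interpreter for
-- codes which is itself given by a total code.

module Submission where

open import Defs
open import Data.Bool using (Bool; true; false; not; _∧_; _∨_)
open import Data.Bool.Properties using (∧-conicalˡ; ∧-conicalʳ; ∨-zeroʳ; not-involutive)
open import Data.Empty using (⊥-elim)
open import Data.Fin using (Fin; zero; suc; _↑ʳ_)
open import Data.Nat using (ℕ; zero; suc; _+_; _≤_; _<_; _≡ᵇ_; pred; _⊔_; z≤n; s≤s)
open import Data.Nat.DivMod using (_/_; _%_; [m+n]%n≡m%n; m/n≡1+[m∸n]/n; m/n<m)
open import Data.Nat.Properties
open import Data.Product using (∃; _×_; _,_; proj₁; proj₂)
open import Data.Sum using (inj₁; inj₂)
open import Data.Vec using (Vec; []; _∷_; lookup; tabulate; map; _++_)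
open import Data.Vec.Properties using (lookup-++ʳ; ∷-injective; map-∘; map-id)
open import Function.Base using (_∘_)
open import Function.Bundles using (Equivalence)
open import Relation.Binary.PropositionalEquality

SUCC : ∀ {n} → Code n → Code n
SUCC a = comp succ (a ∷ [])

ONE : ∀ {n} → Code n
ONE = SUCC zer

PRED : ∀ {n} → Code n → Code n
PRED a = comp (prec zer (proj zero)) (a ∷ [])

ifz : ℕ → ℕ → ℕ → ℕ
ifz zero    b c = b
ifz (suc _) b c = c

IFZ : ∀ {n} → Code n → Code n → Code n → Code n
IFZ a b c = comp (prec (proj zero) (proj (suc (suc (suc zero))))) (a ∷ b ∷ c ∷ [])

module _ {X : SetN} {n} {xs : Vec ℕ n} where

  ev-SUCC : ∀ {a v} → Eval X a xs v → Eval X (SUCC a) xs (suc v)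
  ev-SUCC pa = ev-comp (pa ∷ []) ev-succ

  ev-ONE : Eval X ONE xs 1
  ev-ONE = ev-SUCC ev-zer

  ev-PRED : ∀ {a v} → Eval X a xs v → Eval X (PRED a) xs (pred v)
  ev-PRED pa = ev-comp (pa ∷ []) (ev-pred _)
    where
    ev-pred : ∀ v → Eval X (prec zer (proj zero)) (v ∷ []) (pred v)
    ev-pred zero    = ev-prec0 ev-zer
    ev-pred (suc v) = ev-precS (ev-pred v) (ev-proj zero)

  ev-IFZ : ∀ {a b c va vb vc} → Eval X a xs va → Eval X b xs vb → Eval X c xs vc →
           Eval X (IFZ a b c) xs (ifz va vb vc)
  ev-IFZ pa pb pc = ev-comp (pa ∷ pb ∷ pc ∷ []) (ev-ifz _)
    where
    ev-ifz : ∀ {vb vc} va →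
             Eval X (prec (proj zero) (proj (suc (suc (suc zero))))) (va ∷ vb ∷ vc ∷ []) (ifz va vb vc)
    ev-ifz zero     = ev-prec0 (ev-proj zero)
    ev-ifz (suc va) = ev-precS (ev-ifz va) (ev-proj _)

projs : ∀ {N n} → (Fin n → Fin N) → Vec (Code N) n
projs f = tabulate (λ i → proj (f i))

ev-projs : ∀ {X N n} (f : Fin n → Fin N) {vs : Vec ℕ N} {xs : Vec ℕ n} →
           (∀ i → lookup vs (f i) ≡ lookup xs i) → EvalVec X (projs f) vs xs
ev-projs f {xs = []}     f≗ = []
ev-projs f {xs = x ∷ xs} f≗ =
  subst (Eval _ (proj (f zero)) _) (f≗ zero) (ev-proj (f zero))
  ∷ ev-projs (λ i → f (suc i)) (λ i → f≗ (suc i))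

dropArgs : ∀ N {n} → Vec (Code (N + n)) n
dropArgs N = projs (N ↑ʳ_)

ev-dropArgs : ∀ {X N n} (ys : Vec ℕ N) {xs : Vec ℕ n} → EvalVec X (dropArgs N) (ys ++ xs) xs
ev-dropArgs ys {xs} = ev-projs _ (lookup-++ʳ ys xs)

IsZero : ∀ {n} → Code n → Code n
IsZero a = IFZ a ONE zer

AND OR : ∀ {n} → Code n → Code n → Code n
AND a b = IFZ a zer b
OR  a b = IFZ a b ONE

module _ {X : SetN} {n} {xs : Vec ℕ n} {a : Code n} where

  ev-IsZero : ∀ {v} → Eval X a xs v → Eval X (IsZero a) xs (χ (v ≡ᵇ 0))
  ev-IsZero {zero}  pa = ev-IFZ pa ev-ONE ev-zer
  ev-IsZero {suc _} pa = ev-IFZ pa ev-ONE ev-zer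

  ev-NOT : ∀ {p} → Eval X a xs (χ p) → Eval X (IsZero a) xs (χ (not p))
  ev-NOT {true}  = ev-IsZero
  ev-NOT {false} = ev-IsZero

module _ {X : SetN} {n} {xs : Vec ℕ n} {a b : Code n} where

  ev-AND : ∀ {p q} → Eval X a xs (χ p) → Eval X b xs (χ q) → Eval X (AND a b) xs (χ (p ∧ q))
  ev-AND {true}  pa pb = ev-IFZ pa ev-zer pb
  ev-AND {false} pa pb = ev-IFZ pa ev-zer pb

  ev-OR : ∀ {p q} → Eval X a xs (χ p) → Eval X b xs (χ q) → Eval X (OR a b) xs (χ (p ∨ q))
  ev-OR {true}  pa pb = ev-IFZ pa pb ev-ONE
  ev-OR {false} pa pb = ev-IFZ pa pb ev-ONE

any< all< : (ℕ → Bool) → ℕ → Bool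
any< p zero    = false
any< p (suc k) = any< p k ∨ p k
all< p zero    = true
all< p (suc k) = all< p k ∧ p k

ANY< ALL< : ∀ {n} → Code (suc n) → Code (suc n)
ANY< c = prec zer (OR  (proj (suc zero)) (comp c (proj zero ∷ dropArgs 2)))
ALL< c = prec ONE (AND (proj (suc zero)) (comp c (proj zero ∷ dropArgs 2)))

module _ {X : SetN} {n} {xs : Vec ℕ n} {c : Code (suc n)} {p : ℕ → Bool}
         (ev-c : ∀ i → Eval X c (i ∷ xs) (χ (p i))) where

  ev-ANY< : ∀ k → Eval X (ANY< c) (k ∷ xs) (χ (any< p k))
  ev-ANY< zero    = ev-prec0 ev-zer
  ev-ANY< (suc k) = ev-precS (ev-ANY< k)
    (ev-OR (ev-proj (suc zero)) (ev-comp (ev-proj zero ∷ ev-dropArgs (k ∷ _ ∷ [])) (ev-c k)))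

  ev-ALL< : ∀ k → Eval X (ALL< c) (k ∷ xs) (χ (all< p k))
  ev-ALL< zero    = ev-prec0 ev-ONE
  ev-ALL< (suc k) = ev-precS (ev-ALL< k)
    (ev-AND (ev-proj (suc zero)) (ev-comp (ev-proj zero ∷ ev-dropArgs (k ∷ _ ∷ [])) (ev-c k)))

module _ (p : ℕ → Bool) where

  any<-witness : ∀ k → any< p k ≡ true → ∃ λ i → i < k × p i ≡ true
  any<-witness (suc k) any≡true with any< p k in eq
  ... | true  = let i , i<k , pi = any<-witness k eq in i , m<n⇒m<1+n i<k , pi
  ... | false = k , n<1+n k , any≡true

  any<-intro : ∀ {i k} → i < k → p i ≡ true → any< p k ≡ true
  any<-intro {i} {suc k} i<1+k pi with m<1+n⇒m<n∨m≡n i<1+k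
  ... | inj₁ i<k  = cong (_∨ p k) (any<-intro i<k pi)
  ... | inj₂ refl = trans (cong (any< p k ∨_) pi) (∨-zeroʳ _)

  all<-elim : ∀ k → all< p k ≡ true → ∀ i → i < k → p i ≡ true
  all<-elim (suc k) all≡true i i<1+k with m<1+n⇒m<n∨m≡n i<1+k
  ... | inj₁ i<k  = all<-elim k (∧-conicalˡ _ _ all≡true) i i<k
  ... | inj₂ refl = ∧-conicalʳ _ _ all≡true

  all<-intro : ∀ k → (∀ i → i < k → p i ≡ true) → all< p k ≡ true
  all<-intro zero    _  = refl
  all<-intro (suc k) ps = cong₂ _∧_ (all<-intro k (λ i i<k → ps i (m<n⇒m<1+n i<k))) (ps k (n<1+n k))

module _ {X : SetN} {n} {c : Code (suc n)} {xs : Vec ℕ n} {f : ℕ → ℕ}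
         (ev-c : ∀ y → Eval X c (y ∷ xs) (f y)) where

  ev-mu-total : ∀ s → f s ≡ 0 → ∃ λ x → f x ≡ 0 × Eval X (mu c) xs x
  ev-mu-total s = search 0 s (λ _ ())
    where
    search : ∀ k d → (∀ y → y < k → ∃ λ j → f y ≡ suc j) →
             f (k + d) ≡ 0 → ∃ λ x → f x ≡ 0 × Eval X (mu c) xs x
    search k d below hit with f k in fk
    ... | zero = k , fk , ev-mu (subst (Eval X c _) fk (ev-c k))
                                (λ y y<k → let j , fy = below y y<k in j , subst (Eval X c _) fy (ev-c y))
    search k zero    below hit | suc j =
      ⊥-elim (0≢1+n (trans (sym hit) (trans (cong f (+-identityʳ k)) fk)))
    search k (suc d) below hit | suc j =
      search (suc k) d below′ (subst (λ m → f m ≡ 0) (+-suc k d) hit)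
      where
      below′ : ∀ y → y < suc k → ∃ λ j → f y ≡ suc j
      below′ y y<1+k with m<1+n⇒m<n∨m≡n y<1+k
      ... | inj₁ y<k  = below y y<k
      ... | inj₂ refl = j , fk

ADD : Code 2
ADD = prec (proj zero) (SUCC (proj (suc zero)))

ev-ADD : ∀ {X} m n → Eval X ADD (m ∷ n ∷ []) (m + n)
ev-ADD zero    n = ev-prec0 (ev-proj zero)
ev-ADD (suc m) n = ev-precS (ev-ADD m n) (ev-SUCC (ev-proj (suc zero)))

TRI : Code 1
TRI = prec zer (comp ADD (SUCC (proj zero) ∷ proj (suc zero) ∷ []))

ev-TRI : ∀ {X} k → Eval X TRI (k ∷ []) (tri k)
ev-TRI zero    = ev-prec0 ev-zer
ev-TRI (suc k) =
  ev-precS (ev-TRI k) (ev-comp (ev-SUCC (ev-proj zero) ∷ ev-proj (suc zero) ∷ []) (ev-ADD _ _))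

PAIR : Code 2
PAIR = comp ADD (comp TRI (ADD ∷ []) ∷ proj (suc zero) ∷ [])

ev-PAIR : ∀ {X} u n → Eval X PAIR (u ∷ n ∷ []) ⟨ u , n ⟩
ev-PAIR u n = ev-comp (ev-comp (ev-ADD u n ∷ []) (ev-TRI _) ∷ ev-proj (suc zero) ∷ []) (ev-ADD _ _)

odd : ℕ → Bool
odd zero    = false
odd (suc k) = not (odd k)

half : ℕ → ℕ
half zero    = 0
half (suc k) = half k + χ (odd k)

-- Iterated from the outside, as primitive recursion computes it; bit iterates from the inside.
halvings : ℕ → ℕ → ℕ
halvings zero    u = u
halvings (suc i) u = half (halvings i u)

χ-odd≡%2 : ∀ k → χ (odd k) ≡ k % 2
χ-odd≡%2 zero          = refl
χ-odd≡%2 (suc zero)    = refl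
χ-odd≡%2 (suc (suc k)) = begin
  χ (not (not (odd k))) ≡⟨ cong χ (not-involutive (odd k)) ⟩
  χ (odd k)             ≡⟨ χ-odd≡%2 k ⟩
  k % 2                 ≡⟨ sym ([m+n]%n≡m%n k 2) ⟩
  (k + 2) % 2           ≡⟨ cong (_% 2) (+-comm k 2) ⟩
  suc (suc k) % 2       ∎
  where open ≡-Reasoning

half≡/2 : ∀ k → half k ≡ k / 2
half≡/2 zero          = refl
half≡/2 (suc zero)    = refl
half≡/2 (suc (suc k)) = begin
  half k + χ (odd k) + χ (not (odd k))   ≡⟨ +-assoc (half k) _ _ ⟩
  half k + (χ (odd k) + χ (not (odd k))) ≡⟨ cong (half k +_) (χ+χ-not (odd k)) ⟩
  half k + 1                             ≡⟨ +-comm (half k) 1 ⟩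
  suc (half k)                           ≡⟨ cong suc (half≡/2 k) ⟩
  suc (k / 2)                            ≡⟨ sym (m/n≡1+[m∸n]/n {suc (suc k)} {2} (s≤s (s≤s z≤n))) ⟩
  suc (suc k) / 2                        ∎
  where
  open ≡-Reasoning
  χ+χ-not : ∀ b → χ b + χ (not b) ≡ 1
  χ+χ-not true  = refl
  χ+χ-not false = refl

halvings-half : ∀ i u → halvings i (half u) ≡ half (halvings i u)
halvings-half zero    u = refl
halvings-half (suc i) u = cong half (halvings-half i u)

_∈D?_ : ℕ → ℕ → Bool
i ∈D? u = odd (halvings i u)

bit≡χ-∈D? : ∀ u i → bit u i ≡ χ (i ∈D? u)
bit≡χ-∈D? u zero    = sym (χ-odd≡%2 u)
bit≡χ-∈D? u (suc i) = begin
  bit (u / 2) i                     ≡⟨ bit≡χ-∈D? (u / 2) i ⟩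
  χ (odd (halvings i (u / 2)))      ≡⟨ cong (λ v → χ (odd (halvings i v))) (sym (half≡/2 u)) ⟩
  χ (odd (halvings i (half u)))     ≡⟨ cong (λ v → χ (odd v)) (halvings-half i u) ⟩
  χ (odd (half (halvings i u)))     ∎
  where open ≡-Reasoning

∈D?⇒∈D : ∀ {i u} → i ∈D? u ≡ true → i ∈D u
∈D?⇒∈D {i} {u} i∈?u = trans (bit≡χ-∈D? u i) (cong χ i∈?u)

∈D⇒∈D? : ∀ {i u} → i ∈D u → i ∈D? u ≡ true
∈D⇒∈D? {i} {u} i∈u = χ≡1⇒true (trans (sym (bit≡χ-∈D? u i)) i∈u)
  where
  χ≡1⇒true : ∀ {b} → χ b ≡ 1 → b ≡ true
  χ≡1⇒true {true} _ = refl

bit-≥ : ∀ u i → u ≤ i → bit u i ≡ 0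
bit-≥ zero    zero    _         = refl
bit-≥ zero    (suc i) _         = bit-≥ 0 i z≤n
bit-≥ (suc u) (suc i) (s≤s u≤i) =
  bit-≥ (suc u / 2) i (≤-trans (≤-pred (m/n<m (suc u) 2 (s≤s (s≤s z≤n)))) u≤i)

∈D⇒< : ∀ {i u} → i ∈D u → i < u
∈D⇒< {i} {u} i∈u = ≰⇒> (λ u≤i → 0≢1+n (trans (sym (bit-≥ u i u≤i)) i∈u))

PAR : Code 1
PAR = prec zer (IsZero (proj (suc zero)))

ev-PAR : ∀ {X} k → Eval X PAR (k ∷ []) (χ (odd k))
ev-PAR zero    = ev-prec0 ev-zer
ev-PAR (suc k) = ev-precS (ev-PAR k) (ev-NOT (ev-proj (suc zero)))

HALF : Code 1
HALF = prec zer (comp ADD (proj (suc zero) ∷ comp PAR (proj zero ∷ []) ∷ []))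

ev-HALF : ∀ {X} k → Eval X HALF (k ∷ []) (half k)
ev-HALF zero    = ev-prec0 ev-zer
ev-HALF (suc k) = ev-precS (ev-HALF k)
  (ev-comp (ev-proj (suc zero) ∷ ev-comp (ev-proj zero ∷ []) (ev-PAR k) ∷ []) (ev-ADD _ _))

∈D?-CODE : Code 2
∈D?-CODE = comp PAR (prec (proj zero) (comp HALF (proj (suc zero) ∷ [])) ∷ [])

ev-∈D?-CODE : ∀ {X} i u → Eval X ∈D?-CODE (i ∷ u ∷ []) (χ (i ∈D? u))
ev-∈D?-CODE i u = ev-comp (ev-halvings i ∷ []) (ev-PAR _)
  where
  ev-halvings : ∀ {X} i →
                Eval X (prec (proj zero) (comp HALF (proj (suc zero) ∷ []))) (i ∷ u ∷ []) (halvings i u)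
  ev-halvings zero    = ev-prec0 (ev-proj zero)
  ev-halvings (suc i) = ev-precS (ev-halvings i) (ev-comp (ev-proj (suc zero) ∷ []) (ev-HALF _))

Eventually : (ℕ → Set) → Set
Eventually P = ∃ λ s₀ → ∀ s → s₀ ≤ s → P s

module _ {P Q : ℕ → Set} where

  eventually-map : (∀ {s} → P s → Q s) → Eventually P → Eventually Q
  eventually-map f (s₀ , p) = s₀ , λ s s₀≤s → f (p s s₀≤s)

  eventually-× : Eventually P → Eventually Q → Eventually (λ s → P s × Q s)
  eventually-× (s₁ , p) (s₂ , q) =
    s₁ ⊔ s₂ , λ s le → p s (m⊔n≤o⇒m≤o s₁ s₂ le) , q s (m⊔n≤o⇒n≤o s₁ s₂ le)

eventually-≥ : ∀ k → Eventually (k ≤_)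
eventually-≥ k = k , λ _ k≤s → k≤s

eventually-∀< : ∀ {P : ℕ → ℕ → Set} x → (∀ y → y < x → Eventually (P y)) →
                Eventually (λ s → ∀ y → y < x → P y s)
eventually-∀< zero    _  = 0 , λ _ _ _ ()
eventually-∀< {P} (suc x) ev = eventually-map merge
  (eventually-× (eventually-∀< {P} x (λ y y<x → ev y (m<n⇒m<1+n y<x))) (ev x (n<1+n x)))
  where
  merge : ∀ {s} → (∀ y → y < x → P y s) × P x s → ∀ y → y < suc x → P y s
  merge (below , at) y y<1+x with m<1+n⇒m<n∨m≡n y<1+x
  ... | inj₁ y<x  = below y y<x
  ... | inj₂ refl = at

guard : ∀ {m} → Vec ℕ m → ℕ → ℕ
guard []       r = r
guard (e ∷ es) r = ifz e 0 (guard es r)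

precIter : ℕ → (ℕ → ℕ → ℕ) → ℕ → ℕ
precIter b G zero    = b
precIter b G (suc k) = ifz (precIter b G k) 0 (G k (pred (precIter b G k)))

-- The state after testing F 0, …, F (t − 1), where F y ≡ suc v encodes the output v: 0 while
-- all outputs were positive, 1 once some F y ≡ 0, and suc (suc y) once y is found with output 0.
muStep : ℕ → ℕ → ℕ
muStep t v = ifz v 1 (ifz (pred v) (suc (suc t)) 0)

muState : (ℕ → ℕ) → ℕ → ℕ
muState F zero    = 0
muState F (suc t) = ifz (muState F t) (muStep t (F t)) (muState F t)

-- run X c s xs is suc r if c halts with output r when every unbounded search is cut off after
-- s candidates, and 0 otherwise.
module _ (X : SetN) where
  mutual
    run : ∀ {n} → Code n → ℕ → Vec ℕ n → ℕ
    run zer         s xs       = 1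
    run succ        s (x ∷ []) = suc (suc x)
    run (proj i)    s xs       = suc (lookup xs i)
    run orc         s (x ∷ []) = suc (χ (X x))
    run (comp f gs) s xs       = guard (runs gs s xs) (run f s (map pred (runs gs s xs)))
    run (prec f g)  s (k ∷ xs) = precIter (run f s xs) (λ k r → run g s (k ∷ r ∷ xs)) k
    run (mu f)      s xs       = pred (muState (λ y → run f s (y ∷ xs)) s)

    runs : ∀ {n m} → Vec (Code n) m → ℕ → Vec ℕ n → Vec ℕ m
    runs []       s xs = []
    runs (g ∷ gs) s xs = run g s xs ∷ runs gs s xs

map-pred-suc : ∀ {m} (ys : Vec ℕ m) → map pred (map suc ys) ≡ ys
map-pred-suc ys = trans (sym (map-∘ pred suc ys)) (map-id ys)

guard-map-suc : ∀ {m} (ys : Vec ℕ m) r → guard (map suc ys) r ≡ r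
guard-map-suc []       r = refl
guard-map-suc (y ∷ ys) r = guard-map-suc ys r

guard≡suc : ∀ {m} (es : Vec ℕ m) R {r} → guard es R ≡ suc r →
            ∃ λ ys → es ≡ map suc ys × R ≡ suc r
guard≡suc []           R eq = [] , refl , eq
guard≡suc (suc e ∷ es) R eq =
  let ys , es≡ , R≡ = guard≡suc es R eq in e ∷ ys , cong (suc e ∷_) es≡ , R≡

module _ {F : ℕ → ℕ} where

  muState-searching : ∀ t → (∀ y → y < t → ∃ λ k → F y ≡ suc (suc k)) → muState F t ≡ 0
  muState-searching zero    _     = refl
  muState-searching (suc t) below
    rewrite muState-searching t (λ y y<t → below y (m<n⇒m<1+n y<t)) | proj₂ (below t (n<1+n t)) = refl

  muState-searching⁻¹ : ∀ t → muState F t ≡ 0 → ∀ y → y < t → ∃ λ k → F y ≡ suc (suc k)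
  muState-searching⁻¹ (suc t) st≡0 y y<1+t with muState F t in st | F t in Ft
  ... | zero | suc (suc k) with m<1+n⇒m<n∨m≡n y<1+t
  ...   | inj₁ y<t  = muState-searching⁻¹ t st y y<t
  ...   | inj₂ refl = k , Ft
  muState-searching⁻¹ (suc t) () y y<1+t | zero | zero
  muState-searching⁻¹ (suc t) () y y<1+t | zero | suc zero
  muState-searching⁻¹ (suc t) () y y<1+t | suc _ | _

  muState-found : ∀ t {y} → muState F t ≡ suc (suc y) →
                  F y ≡ 1 × (∀ y′ → y′ < y → ∃ λ k → F y′ ≡ suc (suc k))
  muState-found (suc t) st≡ with muState F t in st | F t in Ft
  ... | suc _ | _ = muState-found t (trans st st≡)
  muState-found (suc t) refl | zero | suc zero = Ft , muState-searching⁻¹ t st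

  muState-found⁻¹ : ∀ {x} → F x ≡ 1 → (∀ y → y < x → ∃ λ k → F y ≡ suc (suc k)) →
                    ∀ t → x < t → muState F t ≡ suc (suc x)
  muState-found⁻¹ {x} Fx below (suc t) x<1+t with m<1+n⇒m<n∨m≡n x<1+t
  ... | inj₁ x<t rewrite muState-found⁻¹ Fx below t x<t = refl
  ... | inj₂ refl rewrite muState-searching x below | Fx = refl

module _ {X : SetN} where
  mutual
    run-sound : ∀ {n} (c : Code n) s xs {r} → run X c s xs ≡ suc r → Eval X c xs r
    run-sound zer      s xs       refl = ev-zer
    run-sound succ     s (x ∷ []) refl = ev-succ
    run-sound (proj i) s xs       refl = ev-proj i
    run-sound orc      s (x ∷ []) refl = ev-orc
    run-sound (comp f gs) s xs eq =
      let ys , gs≡ , f≡ = guard≡suc (runs X gs s xs) _ eq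
      in ev-comp (runs-sound gs s xs gs≡)
                 (run-sound f s ys
                    (trans (cong (run X f s) (sym (trans (cong (map pred) gs≡) (map-pred-suc ys)))) f≡))
    run-sound (prec f g) s (k ∷ xs) eq = precIter-sound f g s xs k eq
    run-sound (mu f) s xs eq with muState (λ y → run X f s (y ∷ xs)) s in st
    run-sound (mu f) s xs refl | suc (suc y) =
      let f≡1 , below = muState-found s st
      in ev-mu (run-sound f s (y ∷ xs) f≡1)
               (λ y′ y′<y → let k , f≡ = below y′ y′<y in k , run-sound f s _ f≡)

    precIter-sound : ∀ {n} (f : Code n) g s xs k {r} →
                     run X (prec f g) s (k ∷ xs) ≡ suc r → Eval X (prec f g) (k ∷ xs) r
    precIter-sound f g s xs zero    eq = ev-prec0 (run-sound f s xs eq)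
    precIter-sound f g s xs (suc k) eq with run X (prec f g) s (k ∷ xs) in it
    ... | suc r′ = ev-precS (precIter-sound f g s xs k it) (run-sound g s _ eq)

    runs-sound : ∀ {n m} (gs : Vec (Code n) m) s xs {ys} →
                 runs X gs s xs ≡ map suc ys → EvalVec X gs xs ys
    runs-sound []       s xs {[]}     eq = []
    runs-sound (g ∷ gs) s xs {y ∷ ys} eq =
      let g≡ , gs≡ = ∷-injective eq in run-sound g s xs g≡ ∷ runs-sound gs s xs gs≡

  mutual
    run-complete : ∀ {n} {c : Code n} {xs r} → Eval X c xs r →
                   Eventually (λ s → run X c s xs ≡ suc r)
    run-complete ev-zer      = 0 , λ _ _ → refl
    run-complete ev-succ     = 0 , λ _ _ → refl
    run-complete (ev-proj i) = 0 , λ _ _ → refl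
    run-complete ev-orc      = 0 , λ _ _ → refl
    run-complete (ev-comp {f = f} {gs} {xs} {ys} {r} ev-gs ev-f) =
      eventually-map combine (eventually-× (runs-complete ev-gs) (run-complete ev-f))
      where
      combine : ∀ {s} → runs X gs s xs ≡ map suc ys × run X f s ys ≡ suc r →
                run X (comp f gs) s xs ≡ suc r
      combine {s} (gs≡ , f≡) = begin
        guard (runs X gs s xs) (run X f s (map pred (runs X gs s xs)))
          ≡⟨ cong (λ v → guard v (run X f s (map pred v))) gs≡ ⟩
        guard (map suc ys) (run X f s (map pred (map suc ys)))
          ≡⟨ cong (λ v → guard (map suc ys) (run X f s v)) (map-pred-suc ys) ⟩
        guard (map suc ys) (run X f s ys)
          ≡⟨ guard-map-suc ys _ ⟩
        run X f s ys
          ≡⟨ f≡ ⟩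
        suc r
          ∎
        where open ≡-Reasoning
    run-complete (ev-prec0 ev-f) = run-complete ev-f
    run-complete (ev-precS {f = f} {g} {xs} {k} {r} {t} ev-prec ev-g) =
      eventually-map combine (eventually-× (run-complete ev-prec) (run-complete ev-g))
      where
      combine : ∀ {s} → run X (prec f g) s (k ∷ xs) ≡ suc r × run X g s (k ∷ r ∷ xs) ≡ suc t →
                run X (prec f g) s (suc k ∷ xs) ≡ suc t
      combine (prec≡ , g≡) rewrite prec≡ = g≡
    run-complete (ev-mu {f = f} {xs} {x} ev-f ev-below) =
      eventually-map found
        (eventually-× (run-complete ev-f)
          (eventually-× (eventually-∀< x (λ y y<x → run-complete-suc (ev-below y y<x)))
                        (eventually-≥ (suc x))))
      where
      found : ∀ {s} → run X f s (x ∷ xs) ≡ 1 ×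
                      (∀ y → y < x → ∃ λ k → run X f s (y ∷ xs) ≡ suc (suc k)) × x < s →
              run X (mu f) s xs ≡ suc x
      found {s} (f≡1 , below , x<s) = cong pred (muState-found⁻¹ f≡1 below s x<s)

    run-complete-suc : ∀ {n} {c : Code n} {xs} → (∃ λ k → Eval X c xs (suc k)) →
                       Eventually (λ s → ∃ λ k → run X c s xs ≡ suc (suc k))
    run-complete-suc (k , ev) = eventually-map (k ,_) (run-complete ev)

    runs-complete : ∀ {n m} {gs : Vec (Code n) m} {xs ys} → EvalVec X gs xs ys →
                    Eventually (λ s → runs X gs s xs ≡ map suc ys)
    runs-complete []            = 0 , λ _ _ → refl
    runs-complete (ev-g ∷ ev-gs) = eventually-map (λ (g≡ , gs≡) → cong₂ _∷_ g≡ gs≡)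
                                     (eventually-× (run-complete ev-g) (runs-complete ev-gs))

GUARD : ∀ {k m} → Vec (Code k) m → Code k → Code k
GUARD []       r = r
GUARD (e ∷ es) r = IFZ e zer (GUARD es r)

ev-GUARD : ∀ {X k m} {es : Vec (Code k) m} {r : Code k} {ys vs vr} →
           EvalVec X es ys vs → Eval X r ys vr → Eval X (GUARD es r) ys (guard vs vr)
ev-GUARD []           ev-r = ev-r
ev-GUARD (ev-e ∷ ev-es) ev-r = ev-IFZ ev-e ev-zer (ev-GUARD ev-es ev-r)

ev-map-PRED : ∀ {X k m} {es : Vec (Code k) m} {ys vs} →
              EvalVec X es ys vs → EvalVec X (map PRED es) ys (map pred vs)
ev-map-PRED []           = []
ev-map-PRED (ev ∷ evs) = ev-PRED ev ∷ ev-map-PRED evs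

PREC-STEP : ∀ {n} → Code (3 + n) → Code (3 + n)
PREC-STEP g′ = IFZ (proj (suc zero)) zer
  (comp g′ (proj (suc (suc zero)) ∷ proj zero ∷ PRED (proj (suc zero)) ∷ dropArgs 3))

MU-STEP : ∀ {n} → Code (2 + n) → Code (3 + n)
MU-STEP {n} f′ =
  IFZ (proj (suc zero)) (IFZ F ONE (IFZ (PRED F) (SUCC (SUCC (proj zero))) zer)) (proj (suc zero))
  where
  F : Code (3 + n)
  F = comp f′ (proj (suc (suc zero)) ∷ proj zero ∷ dropArgs 3)

module _ {X Y : SetN} (X≤TY : X ≤T Y) where

  mutual
    RUN : ∀ {n} → Code n → Code (suc n)
    RUN zer         = ONE
    RUN succ        = SUCC (SUCC (proj (suc zero)))
    RUN (proj i)    = SUCC (proj (suc i))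
    RUN orc         = SUCC (comp (proj₁ X≤TY) (proj (suc zero) ∷ []))
    RUN (comp f gs) = GUARD (RUNS gs) (comp (RUN f) (proj zero ∷ map PRED (RUNS gs)))
    RUN (prec f g)  =
      comp (prec (RUN f) (PREC-STEP (RUN g))) (proj (suc zero) ∷ proj zero ∷ dropArgs 2)
    RUN (mu f)      = PRED (comp (prec zer (MU-STEP (RUN f))) (proj zero ∷ proj zero ∷ dropArgs 1))

    RUNS : ∀ {n m} → Vec (Code n) m → Vec (Code (suc n)) m
    RUNS []       = []
    RUNS (g ∷ gs) = RUN g ∷ RUNS gs

  mutual
    ev-RUN : ∀ {n} (c : Code n) s xs → Eval Y (RUN c) (s ∷ xs) (run X c s xs)
    ev-RUN zer      s xs       = ev-ONE
    ev-RUN succ     s (x ∷ []) = ev-SUCC (ev-SUCC (ev-proj (suc zero)))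
    ev-RUN (proj i) s xs       = ev-SUCC (ev-proj (suc i))
    ev-RUN orc      s (x ∷ []) = ev-SUCC (ev-comp (ev-proj (suc zero) ∷ []) (proj₂ X≤TY x))
    ev-RUN (comp f gs) s xs =
      ev-GUARD (ev-RUNS gs s xs)
        (ev-comp (ev-proj zero ∷ ev-map-PRED (ev-RUNS gs s xs)) (ev-RUN f s _))
    ev-RUN (prec f g) s (k ∷ xs) =
      ev-comp (ev-proj (suc zero) ∷ ev-proj zero ∷ ev-dropArgs (s ∷ k ∷ [])) (ev-precIter f g s xs k)
    ev-RUN (mu f) s xs =
      ev-PRED (ev-comp (ev-proj zero ∷ ev-proj zero ∷ ev-dropArgs (s ∷ [])) (ev-muState f s xs s))

    ev-precIter : ∀ {n} (f : Code n) g s xs k →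
      Eval Y (prec (RUN f) (PREC-STEP (RUN g))) (k ∷ s ∷ xs) (run X (prec f g) s (k ∷ xs))
    ev-precIter f g s xs zero    = ev-prec0 (ev-RUN f s xs)
    ev-precIter f g s xs (suc k) =
      ev-precS (ev-precIter f g s xs k)
        (ev-IFZ (ev-proj (suc zero)) ev-zer
          (ev-comp (ev-proj (suc (suc zero)) ∷ ev-proj zero ∷ ev-PRED (ev-proj (suc zero))
                    ∷ ev-dropArgs (k ∷ _ ∷ s ∷ []))
                   (ev-RUN g s _)))

    ev-muState : ∀ {n} (f : Code (suc n)) s xs t →
      Eval Y (prec zer (MU-STEP (RUN f))) (t ∷ s ∷ xs) (muState (λ y → run X f s (y ∷ xs)) t)
    ev-muState f s xs zero    = ev-prec0 ev-zer
    ev-muState f s xs (suc t) =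
      ev-precS (ev-muState f s xs t)
        (ev-IFZ (ev-proj (suc zero))
                (ev-IFZ ev-F ev-ONE (ev-IFZ (ev-PRED ev-F) (ev-SUCC (ev-SUCC (ev-proj zero))) ev-zer))
                (ev-proj (suc zero)))
      where
      state : ℕ
      state = muState (λ y → run X f s (y ∷ xs)) t
      ev-F : Eval Y (comp (RUN f) (proj (suc (suc zero)) ∷ proj zero ∷ dropArgs 3))
                    (t ∷ state ∷ s ∷ xs) (run X f s (t ∷ xs))
      ev-F = ev-comp (ev-proj (suc (suc zero)) ∷ ev-proj zero ∷ ev-dropArgs (t ∷ state ∷ s ∷ []))
                     (ev-RUN f s (t ∷ xs))

    ev-RUNS : ∀ {n m} (gs : Vec (Code n) m) s xs → EvalVec Y (RUNS gs) (s ∷ xs) (runs X gs s xs)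
    ev-RUNS []       s xs = []
    ev-RUNS (g ∷ gs) s xs = ev-RUN g s xs ∷ ev-RUNS gs s xs

∅≤T : ∀ X → ∅ ≤T X
∅≤T X = zer , λ _ → ev-zer

record _CEIn_ (A X : SetN) : Set where
  field
    stage    : ℕ → SetN
    code     : Code 2
    computes : ∀ s n → Eval X code (s ∷ n ∷ []) (χ (stage s n))
    sound    : ∀ {s n} → stage s n ≡ true → A n ≡ true
    complete : ∀ {n} → A n ≡ true → Eventually (λ s → stage s n ≡ true)

CE⇒CEIn : ∀ {W X} → CE W → W CEIn X
CE⇒CEIn {W} {X} (w , W≡dom) = record
  { stage    = λ s n → not (halts s n ≡ᵇ 0)
  ; code     = IsZero (IsZero (RUN (∅≤T X) w))
  ; computes = λ s n → ev-NOT (ev-IsZero (ev-RUN (∅≤T X) w s (n ∷ [])))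
  ; sound    = λ {s} {n} → sound s n
  ; complete = λ {n} Wn → let r , ev = Equivalence.to (W≡dom n) Wn in
                 eventually-map (cong (λ v → not (v ≡ᵇ 0))) (run-complete ev)
  }
  where
  halts : ℕ → ℕ → ℕ
  halts s n = run ∅ w s (n ∷ [])
  sound : ∀ s n → not (halts s n ≡ᵇ 0) ≡ true → W n ≡ true
  sound s n _ with halts s n in h
  ... | suc r = Equivalence.from (W≡dom n) (r , run-sound w s (n ∷ []) h)

-- Testing i < u suffices, since D_u ⊆ {0, …, u − 1} (∈D⇒<).
D_⊆?_ : ℕ → SetN → Bool
D u ⊆? X = all< (λ i → not (i ∈D? u) ∨ X i) u

D⊆?-CODE : Code 1
D⊆?-CODE =
  comp (ALL< (OR (IsZero ∈D?-CODE) (comp orc (proj zero ∷ [])))) (proj zero ∷ proj zero ∷ [])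

ev-D⊆?-CODE : ∀ {X} u → Eval X D⊆?-CODE (u ∷ []) (χ (D u ⊆? X))
ev-D⊆?-CODE u = ev-comp (ev-proj zero ∷ ev-proj zero ∷ [])
  (ev-ALL< (λ i → ev-OR (ev-NOT (ev-∈D?-CODE i u)) (ev-comp (ev-proj zero ∷ []) ev-orc)) u)

module _ {X : SetN} {u : ℕ} where

  D⊆?-sound : D u ⊆? X ≡ true → ∀ i → i ∈D u → X i ≡ true
  D⊆?-sound D⊆X i i∈u =
    subst (λ b → not b ∨ X i ≡ true) (∈D⇒∈D? {i} {u} i∈u) (all<-elim _ u D⊆X i (∈D⇒< i∈u))

  D⊆?-complete : (∀ i → i ∈D u → X i ≡ true) → D u ⊆? X ≡ true
  D⊆?-complete D⊆X = all<-intro _ u check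
    where
    check : ∀ i → i < u → not (i ∈D? u) ∨ X i ≡ true
    check i _ with i ∈D? u in i∈?u
    ... | true  = D⊆X i (∈D?⇒∈D {i} {u} i∈?u)
    ... | false = refl

≤e⇒CEIn : ∀ {A X} → A ≤e X → A CEIn X
≤e⇒CEIn {A} {X} (Θ , Θ-ce , A≡ΘX) = record
  { stage = stage ; code = code ; computes = computes
  ; sound = λ {s} {n} → sound {s} {n} ; complete = complete }
  where
  module Θ = _CEIn_ (CE⇒CEIn {X = X} Θ-ce)

  stage : ℕ → SetN
  stage s n = any< (λ u → Θ.stage s ⟨ u , n ⟩ ∧ D u ⊆? X) s

  Θ-stage-at : Code 3
  Θ-stage-at = comp Θ.code (proj (suc zero) ∷ comp PAIR (proj zero ∷ proj (suc (suc zero)) ∷ []) ∷ [])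

  code : Code 2
  code = comp (ANY< (AND Θ-stage-at (comp D⊆?-CODE (proj zero ∷ []))))
              (proj zero ∷ proj zero ∷ proj (suc zero) ∷ [])

  computes : ∀ s n → Eval X code (s ∷ n ∷ []) (χ (stage s n))
  computes s n = ev-comp (ev-proj zero ∷ ev-proj zero ∷ ev-proj (suc zero) ∷ []) (ev-ANY< candidate s)
    where
    candidate : ∀ u → Eval X (AND Θ-stage-at (comp D⊆?-CODE (proj zero ∷ []))) (u ∷ s ∷ n ∷ [])
                             (χ (Θ.stage s ⟨ u , n ⟩ ∧ D u ⊆? X))
    candidate u = ev-AND
      (ev-comp (ev-proj (suc zero)
                ∷ ev-comp (ev-proj zero ∷ ev-proj (suc (suc zero)) ∷ []) (ev-PAIR u n) ∷ [])
               (Θ.computes s ⟨ u , n ⟩))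
      (ev-comp (ev-proj zero ∷ []) (ev-D⊆?-CODE u))

  sound : ∀ {s n} → stage s n ≡ true → A n ≡ true
  sound {s} {n} staged =
    let u , _ , found = any<-witness _ s staged
    in Equivalence.from (A≡ΘX n)
         (u , D⊆?-sound (∧-conicalʳ _ _ found) , Θ.sound (∧-conicalˡ _ _ found))

  complete : ∀ {n} → A n ≡ true → Eventually (λ s → stage s n ≡ true)
  complete {n} An =
    let u , D⊆X , Θ⟨u,n⟩ = Equivalence.to (A≡ΘX n) An
    in eventually-map (λ (Θ≡ , u<s) → any<-intro _ u<s (cong₂ _∧_ Θ≡ (D⊆?-complete D⊆X)))
                      (eventually-× (Θ.complete Θ⟨u,n⟩) (eventually-≥ (suc u)))

∁-true⇒false : ∀ {A : SetN} n → ∁ A n ≡ true → A n ≡ false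
∁-true⇒false {A} n _ with A n
... | false = refl

false⇒∁-true : ∀ {A : SetN} n → A n ≡ false → ∁ A n ≡ true
false⇒∁-true n An rewrite An = refl

CEIn-∁⇒≤T : ∀ {A X} → A CEIn X → ∁ A CEIn X → A ≤T X
CEIn-∁⇒≤T {A} {X} A-ce ∁A-ce = comp A.code (mu unsettled ∷ proj zero ∷ []) , decides
  where
  module A = _CEIn_ A-ce
  module ∁A = _CEIn_ ∁A-ce

  settled : ℕ → SetN
  settled s n = A.stage s n ∨ ∁A.stage s n

  unsettled : Code 2
  unsettled = IsZero (OR A.code ∁A.code)

  settles : ∀ n → ∃ λ s → settled s n ≡ true
  settles n with A n in An
  ... | true  = let s , staged = A.complete An in s , cong (_∨ _) (staged s ≤-refl)
  ... | false = let s , staged = ∁A.complete (false⇒∁-true {A} n An) in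
                s , trans (cong (A.stage s n ∨_) (staged s ≤-refl)) (∨-zeroʳ _)

  settled⇒stage≡ : ∀ {s n} → settled s n ≡ true → A.stage s n ≡ A n
  settled⇒stage≡ {s} {n} settled≡ with A.stage s n in staged
  ... | true  = sym (A.sound staged)
  ... | false = sym (∁-true⇒false {A} n (∁A.sound settled≡))

  decides : ∀ n → Eval X (comp A.code (mu unsettled ∷ proj zero ∷ [])) (n ∷ []) (χ (A n))
  decides n =
    let s , settled≡ = settles n
        x , unsettled≡0 , ev-search =
          ev-mu-total (λ s → ev-NOT (ev-OR (A.computes s n) (∁A.computes s n)))
                      s (cong (χ ∘ not) settled≡)
    in subst (Eval X _ (n ∷ [])) (cong χ (settled⇒stage≡ (χ-not≡0 unsettled≡0)))
             (ev-comp (ev-search ∷ ev-proj zero ∷ []) (A.computes x n))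
    where
    χ-not≡0 : ∀ {b} → χ (not b) ≡ 0 → b ≡ true
    χ-not≡0 {true} _ = refl

corollary4p4 : (A : SetN) → Introenumerable A → CE (∁ A) → Introreducible A
corollary4p4 A (A-infinite , A-introenumerable) ∁A-ce =
  A-infinite , λ C C-infinite C⊆A →
    CEIn-∁⇒≤T (≤e⇒CEIn (A-introenumerable C C-infinite C⊆A)) (CE⇒CEIn ∁A-ce)
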